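{- If $G$ is the disjoint union of finitely many finite simple graphs $G_1,\dots,G_r$, then $\gamma_{\mathrm{aut}}(G) = \sum_{i=1}^r \gamma_{\mathrm{aut}}(G_i)$.
   Context: For $G=(V,E)$: two dominating sets $S,S'$ are adjacent if there are $v\in S$, $v'\in S'$ with $vv'\in E$ and $S'=(S\setminus\{v\})\cup\{v'\}$. A collection $\mathcal{F}$ of subsets of $V$ is an autonomously dominating family if: (1) every member is a dominating set; (2) for each $S\in\mathcal{F}$ and each $v\in V\setminus S$ there is $S'\in\mathcal{F}$ adjacent to $S$ with $v\in S'$; (3) for each $S\in\mathcal{F}$, every dominating set adjacent to $S$ belongs to $\mathcal{F}$. An autonomous dominating set is a member of some autonomously dominating family; $\gamma_{\mathrm{aut}}(G)$ is the least size of one. -}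

module Defs where

open import Data.Nat using (ℕ; zero; suc; _+_; _≤_)
open import Data.Fin using (Fin; splitAt)
open import Data.Fin.Subset using (Subset; _∈_; _∉_; _∪_; _-_; ⁅_⁆; ∣_∣)
open import Data.Sum using (_⊎_; inj₁; inj₂)
open import Data.Product using (Σ; ∃; _×_; _,_)
open import Data.Empty using (⊥)
open import Data.Vec using (sum; tabulate)
open import Relation.Nullary using (¬_)
open import Relation.Binary.PropositionalEquality using (_≡_)

record Graph : Set₁ where
  field
    n      : ℕ
    Adj    : Fin n → Fin n → Set
    sym    : ∀ {u v} → Adj u v → Adj v u
    irrefl : ∀ {v} → ¬ Adj v v
open Graph public

-- Disjoint union.  Vertices of G ⊕ H are Fin (n G + n H); the first
-- n G of them are the vertices of G, the rest those of H (via splitAt).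

sumAdj : ∀ {m k} → (Fin m → Fin m → Set) → (Fin k → Fin k → Set)
       → Fin m ⊎ Fin k → Fin m ⊎ Fin k → Set
sumAdj A B (inj₁ a) (inj₁ b) = A a b
sumAdj A B (inj₁ a) (inj₂ b) = ⊥
sumAdj A B (inj₂ a) (inj₁ b) = ⊥
sumAdj A B (inj₂ a) (inj₂ b) = B a b

sumAdj-sym : ∀ {m k} (A : Fin m → Fin m → Set) (B : Fin k → Fin k → Set)
           → (∀ {u v} → A u v → A v u) → (∀ {u v} → B u v → B v u)
           → ∀ x y → sumAdj A B x y → sumAdj A B y x
sumAdj-sym A B sA sB (inj₁ a) (inj₁ b) p = sA p
sumAdj-sym A B sA sB (inj₂ a) (inj₂ b) p = sB p

sumAdj-irrefl : ∀ {m k} (A : Fin m → Fin m → Set) (B : Fin k → Fin k → Set)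
              → (∀ {v} → ¬ A v v) → (∀ {v} → ¬ B v v)
              → ∀ x → ¬ sumAdj A B x x
sumAdj-irrefl A B iA iB (inj₁ a) p = iA p
sumAdj-irrefl A B iA iB (inj₂ a) p = iB p

_⊕_ : Graph → Graph → Graph
G ⊕ H = record
  { n      = n G + n H
  ; Adj    = λ u v → sumAdj (Adj G) (Adj H) (splitAt (n G) u) (splitAt (n G) v)
  ; sym    = λ {u} {v} → sumAdj-sym (Adj G) (Adj H) (sym G) (sym H)
                           (splitAt (n G) u) (splitAt (n G) v)
  ; irrefl = λ {v} → sumAdj-irrefl (Adj G) (Adj H) (irrefl G) (irrefl H)
                           (splitAt (n G) v)
  }

emptyGraph : Graph
emptyGraph = record { n = 0 ; Adj = λ () ; sym = λ {} ; irrefl = λ {} }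

⨁ : (r : ℕ) → (Fin r → Graph) → Graph
⨁ zero    G = emptyGraph
⨁ (suc r) G = G Fin.zero ⊕ ⨁ r (λ i → G (Fin.suc i))

module _ (G : Graph) where

  Dominating : Subset (n G) → Set
  Dominating S = ∀ v → v ∈ S ⊎ Σ (Fin (n G)) (λ u → u ∈ S × Adj G u v)

  AdjacentDS : Subset (n G) → Subset (n G) → Set
  AdjacentDS S S' =
    Dominating S × Dominating S' ×
    Σ (Fin (n G)) (λ v → Σ (Fin (n G)) (λ v' →
      v ∈ S × v' ∈ S' × Adj G v v' × S' ≡ (S - v) ∪ ⁅ v' ⁆))

  record AutDomFamily (F : Subset (n G) → Set) : Set where
    field
      dom    : ∀ S → F S → Dominating S
      reach  : ∀ S → F S → ∀ v → v ∉ S →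
               Σ (Subset (n G)) (λ S' → F S' × AdjacentDS S S' × v ∈ S')
      closed : ∀ S → F S → ∀ S' → Dominating S' → AdjacentDS S S' → F S'

  AutonomousDS : Subset (n G) → Set₁
  AutonomousDS S = Σ (Subset (n G) → Set) (λ F → AutDomFamily F × F S)

  IsγAut : ℕ → Set₁
  IsγAut k = Σ (Subset (n G)) (λ S → AutonomousDS S × ∣ S ∣ ≡ k)
           × (∀ S → AutonomousDS S → k ≤ ∣ S ∣)

{-# OPTIONS --safe #-}
module Submission where

-- A dominating set of G ⊕ H is a concatenation A ++ B of dominating sets of
-- G and H, and since no edge joins the two parts, every exchange step of
-- G ⊕ H is an exchange step of G on A or of H on B.  Hence the product of
-- autonomously dominating families of G and H is one of G ⊕ H, and conversely
-- the two sections of an autonomously dominating family of G ⊕ H are such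
-- families of G and of H.  So A ++ B is autonomous exactly when A and B are,
-- γ_aut is additive under ⊕, and the theorem follows by induction on r.

open import Defs
open import Data.Nat using (ℕ; zero; suc; _+_; _≤_; z≤n)
open import Data.Nat.Properties using (+-mono-≤)
open import Data.Fin using (Fin; splitAt; _↑ˡ_; _↑ʳ_)
import Data.Fin as Fin
open import Data.Fin.Properties using (splitAt-↑ˡ; splitAt-↑ʳ)
open import Data.Fin.Subset
  using (Subset; _∈_; _∪_; _─_; ⁅_⁆; ∣_∣; outside; inside)
  renaming (⊥ to ∅)
open import Data.Fin.Subset.Properties using (∪-identityʳ; p─⊥≡p)
open import Data.Vec using ([]; _∷_; _++_; sum; tabulate)
import Data.Vec as Vec
open import Data.Vec.Properties
  using (lookup-++ˡ; lookup-++ʳ; []=⇒lookup; lookup⇒[]=; zipWith-++)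
open import Data.Sum using (inj₁; inj₂)
open import Data.Product using (∃; _×_; _,_; proj₁; proj₂)
open import Data.Empty using (⊥-elim)
open import Data.Unit using (⊤; tt)
open import Relation.Nullary using (¬_)
open import Relation.Binary.PropositionalEquality
  using (_≡_; refl; trans; cong; cong₂; subst; subst₂; module ≡-Reasoning)
import Relation.Binary.PropositionalEquality as ≡

data SplitView (m k : ℕ) : Fin (m + k) → Set where
  left  : (i : Fin m) → SplitView m k (i ↑ˡ k)
  right : (j : Fin k) → SplitView m k (m ↑ʳ j)

splitView : ∀ m k (x : Fin (m + k)) → SplitView m k x
splitView zero    k x            = right x
splitView (suc m) k Fin.zero     = left Fin.zero
splitView (suc m) k (Fin.suc x) with splitView m k x
... | left i  = left (Fin.suc i)
... | right j = right j

module _ {m k : ℕ} (A : Subset m) (B : Subset k) where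

  ∈-++⁺ˡ : ∀ {i} → i ∈ A → (i ↑ˡ k) ∈ A ++ B
  ∈-++⁺ˡ {i} p = lookup⇒[]= _ _ (trans (lookup-++ˡ A B i) ([]=⇒lookup p))

  ∈-++⁻ˡ : ∀ {i} → (i ↑ˡ k) ∈ A ++ B → i ∈ A
  ∈-++⁻ˡ {i} p = lookup⇒[]= _ _ (trans (≡.sym (lookup-++ˡ A B i)) ([]=⇒lookup p))

  ∈-++⁺ʳ : ∀ {j} → j ∈ B → (m ↑ʳ j) ∈ A ++ B
  ∈-++⁺ʳ {j} p = lookup⇒[]= _ _ (trans (lookup-++ʳ A B j) ([]=⇒lookup p))

  ∈-++⁻ʳ : ∀ {j} → (m ↑ʳ j) ∈ A ++ B → j ∈ B
  ∈-++⁻ʳ {j} p = lookup⇒[]= _ _ (trans (≡.sym (lookup-++ʳ A B j)) ([]=⇒lookup p))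

∣p++q∣≡∣p∣+∣q∣ : ∀ {m k} (p : Subset m) (q : Subset k) → ∣ p ++ q ∣ ≡ ∣ p ∣ + ∣ q ∣
∣p++q∣≡∣p∣+∣q∣ []            q = refl
∣p++q∣≡∣p∣+∣q∣ (inside ∷ p)  q = cong suc (∣p++q∣≡∣p∣+∣q∣ p q)
∣p++q∣≡∣p∣+∣q∣ (outside ∷ p) q = ∣p++q∣≡∣p∣+∣q∣ p q

∅-++ : ∀ m k → ∅ {m + k} ≡ ∅ {m} ++ ∅ {k}
∅-++ zero    k = refl
∅-++ (suc m) k = cong (outside ∷_) (∅-++ m k)

⁅↑ˡ⁆ : ∀ {m} k (i : Fin m) → ⁅ i ↑ˡ k ⁆ ≡ ⁅ i ⁆ ++ ∅ {k}
⁅↑ˡ⁆ {suc m} k Fin.zero    = cong (inside ∷_) (∅-++ m k)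
⁅↑ˡ⁆ {suc m} k (Fin.suc i) = cong (outside ∷_) (⁅↑ˡ⁆ k i)

⁅↑ʳ⁆ : ∀ m {k} (j : Fin k) → ⁅ m ↑ʳ j ⁆ ≡ ∅ {m} ++ ⁅ j ⁆
⁅↑ʳ⁆ zero    j = refl
⁅↑ʳ⁆ (suc m) j = cong (outside ∷_) (⁅↑ʳ⁆ m j)

exchange : ∀ {n} → Subset n → Subset n → Subset n → Subset n
exchange S X Y = (S ─ X) ∪ Y

exchange-++ : ∀ {m k} (A C E : Subset m) (B D F : Subset k)
            → exchange (A ++ B) (C ++ D) (E ++ F) ≡ exchange A C E ++ exchange B D F
exchange-++ A C E B D F =
  trans (cong (_∪ (E ++ F)) (zipWith-++ _ A B C D)) (zipWith-++ _ (A ─ C) (B ─ D) E F)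

exchange-∅ : ∀ {n} (S : Subset n) → exchange S ∅ ∅ ≡ S
exchange-∅ S = trans (∪-identityʳ (S ─ ∅)) (p─⊥≡p S)

exchange-↑ˡ : ∀ {m k} (A : Subset m) (B : Subset k) a a'
            → exchange (A ++ B) ⁅ a ↑ˡ k ⁆ ⁅ a' ↑ˡ k ⁆ ≡ exchange A ⁅ a ⁆ ⁅ a' ⁆ ++ B
exchange-↑ˡ {m} {k} A B a a' = begin
  exchange (A ++ B) ⁅ a ↑ˡ k ⁆ ⁅ a' ↑ˡ k ⁆
    ≡⟨ cong₂ (exchange (A ++ B)) (⁅↑ˡ⁆ k a) (⁅↑ˡ⁆ k a') ⟩
  exchange (A ++ B) (⁅ a ⁆ ++ ∅) (⁅ a' ⁆ ++ ∅)
    ≡⟨ exchange-++ A ⁅ a ⁆ ⁅ a' ⁆ B ∅ ∅ ⟩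
  exchange A ⁅ a ⁆ ⁅ a' ⁆ ++ exchange B ∅ ∅
    ≡⟨ cong (exchange A ⁅ a ⁆ ⁅ a' ⁆ ++_) (exchange-∅ B) ⟩
  exchange A ⁅ a ⁆ ⁅ a' ⁆ ++ B ∎
  where open ≡-Reasoning

exchange-↑ʳ : ∀ {m k} (A : Subset m) (B : Subset k) b b'
            → exchange (A ++ B) ⁅ m ↑ʳ b ⁆ ⁅ m ↑ʳ b' ⁆ ≡ A ++ exchange B ⁅ b ⁆ ⁅ b' ⁆
exchange-↑ʳ {m} {k} A B b b' = begin
  exchange (A ++ B) ⁅ m ↑ʳ b ⁆ ⁅ m ↑ʳ b' ⁆
    ≡⟨ cong₂ (exchange (A ++ B)) (⁅↑ʳ⁆ m b) (⁅↑ʳ⁆ m b') ⟩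
  exchange (A ++ B) (∅ ++ ⁅ b ⁆) (∅ ++ ⁅ b' ⁆)
    ≡⟨ exchange-++ A ∅ ∅ B ⁅ b ⁆ ⁅ b' ⁆ ⟩
  exchange A ∅ ∅ ++ exchange B ⁅ b ⁆ ⁅ b' ⁆
    ≡⟨ cong (_++ exchange B ⁅ b ⁆ ⁅ b' ⁆) (exchange-∅ A) ⟩
  A ++ exchange B ⁅ b ⁆ ⁅ b' ⁆ ∎
  where open ≡-Reasoning

module DisjointUnion (G H : Graph) where

  private
    m k : ℕ
    m = n G
    k = n H

    SumAdj = sumAdj (Adj G) (Adj H)

  adj-↑ˡ⁻ : ∀ {i j} → Adj (G ⊕ H) (i ↑ˡ k) (j ↑ˡ k) → Adj G i j
  adj-↑ˡ⁻ {i} {j} = subst₂ SumAdj (splitAt-↑ˡ m i k) (splitAt-↑ˡ m j k)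

  adj-↑ˡ⁺ : ∀ {i j} → Adj G i j → Adj (G ⊕ H) (i ↑ˡ k) (j ↑ˡ k)
  adj-↑ˡ⁺ {i} {j} = subst₂ SumAdj (≡.sym (splitAt-↑ˡ m i k)) (≡.sym (splitAt-↑ˡ m j k))

  adj-↑ʳ⁻ : ∀ {i j} → Adj (G ⊕ H) (m ↑ʳ i) (m ↑ʳ j) → Adj H i j
  adj-↑ʳ⁻ {i} {j} = subst₂ SumAdj (splitAt-↑ʳ m k i) (splitAt-↑ʳ m k j)

  adj-↑ʳ⁺ : ∀ {i j} → Adj H i j → Adj (G ⊕ H) (m ↑ʳ i) (m ↑ʳ j)
  adj-↑ʳ⁺ {i} {j} = subst₂ SumAdj (≡.sym (splitAt-↑ʳ m k i)) (≡.sym (splitAt-↑ʳ m k j))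

  ¬adj-↑ˡ↑ʳ : ∀ i j → ¬ Adj (G ⊕ H) (i ↑ˡ k) (m ↑ʳ j)
  ¬adj-↑ˡ↑ʳ i j = subst₂ SumAdj (splitAt-↑ˡ m i k) (splitAt-↑ʳ m k j)

  ¬adj-↑ʳ↑ˡ : ∀ i j → ¬ Adj (G ⊕ H) (m ↑ʳ j) (i ↑ˡ k)
  ¬adj-↑ʳ↑ˡ i j = subst₂ SumAdj (splitAt-↑ʳ m k j) (splitAt-↑ˡ m i k)

  dominating-++⁻ˡ : ∀ A B → Dominating (G ⊕ H) (A ++ B) → Dominating G A
  dominating-++⁻ˡ A B dom v with dom (v ↑ˡ k)
  ... | inj₁ v∈ = inj₁ (∈-++⁻ˡ A B v∈)
  ... | inj₂ (u , u∈ , uv) with splitView m k u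
  ...   | left i  = inj₂ (i , ∈-++⁻ˡ A B u∈ , adj-↑ˡ⁻ uv)
  ...   | right j = ⊥-elim (¬adj-↑ʳ↑ˡ v j uv)

  dominating-++⁻ʳ : ∀ A B → Dominating (G ⊕ H) (A ++ B) → Dominating H B
  dominating-++⁻ʳ A B dom v with dom (m ↑ʳ v)
  ... | inj₁ v∈ = inj₁ (∈-++⁻ʳ A B v∈)
  ... | inj₂ (u , u∈ , uv) with splitView m k u
  ...   | left i  = ⊥-elim (¬adj-↑ˡ↑ʳ i v uv)
  ...   | right j = inj₂ (j , ∈-++⁻ʳ A B u∈ , adj-↑ʳ⁻ uv)

  dominating-++⁺ : ∀ A B → Dominating G A → Dominating H B → Dominating (G ⊕ H) (A ++ B)
  dominating-++⁺ A B domA domB x with splitView m k x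
  ... | left i with domA i
  ...   | inj₁ i∈ = inj₁ (∈-++⁺ˡ A B i∈)
  ...   | inj₂ (u , u∈ , ui) = inj₂ (u ↑ˡ k , ∈-++⁺ˡ A B u∈ , adj-↑ˡ⁺ ui)
  dominating-++⁺ A B domA domB x | right j with domB j
  ...   | inj₁ j∈ = inj₁ (∈-++⁺ʳ A B j∈)
  ...   | inj₂ (u , u∈ , uj) = inj₂ (m ↑ʳ u , ∈-++⁺ʳ A B u∈ , adj-↑ʳ⁺ uj)

  adjacentDS-++⁺ˡ : ∀ A A' B → Dominating H B
                  → AdjacentDS G A A' → AdjacentDS (G ⊕ H) (A ++ B) (A' ++ B)
  adjacentDS-++⁺ˡ A A' B domB (domA , domA' , a , a' , a∈ , a'∈ , aa' , refl) =
    dominating-++⁺ A B domA domB , dominating-++⁺ A' B domA' domB ,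
    a ↑ˡ k , a' ↑ˡ k , ∈-++⁺ˡ A B a∈ , ∈-++⁺ˡ A' B a'∈ , adj-↑ˡ⁺ aa' ,
    ≡.sym (exchange-↑ˡ A B a a')

  adjacentDS-++⁺ʳ : ∀ A B B' → Dominating G A
                  → AdjacentDS H B B' → AdjacentDS (G ⊕ H) (A ++ B) (A ++ B')
  adjacentDS-++⁺ʳ A B B' domA (domB , domB' , b , b' , b∈ , b'∈ , bb' , refl) =
    dominating-++⁺ A B domA domB , dominating-++⁺ A B' domA domB' ,
    m ↑ʳ b , m ↑ʳ b' , ∈-++⁺ʳ A B b∈ , ∈-++⁺ʳ A B' b'∈ , adj-↑ʳ⁺ bb' ,
    ≡.sym (exchange-↑ʳ A B b b')

  data AdjacentDS-++ (A : Subset m) (B : Subset k) : Subset (m + k) → Set where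
    left  : ∀ A' → AdjacentDS G A A' → AdjacentDS-++ A B (A' ++ B)
    right : ∀ B' → AdjacentDS H B B' → AdjacentDS-++ A B (A ++ B')

  adjacentDS-++⁻ : ∀ A B S' → AdjacentDS (G ⊕ H) (A ++ B) S' → AdjacentDS-++ A B S'
  adjacentDS-++⁻ A B S' (dom , dom' , x , x' , x∈ , x'∈ , xx' , S'≡)
    with splitView m k x | splitView m k x'
  ... | left a  | right b' = ⊥-elim (¬adj-↑ˡ↑ʳ a b' xx')
  ... | right b | left a'  = ⊥-elim (¬adj-↑ʳ↑ˡ a' b xx')
  ... | left a  | left a'
    rewrite trans S'≡ (exchange-↑ˡ A B a a') =
      left _ (dominating-++⁻ˡ A B dom , dominating-++⁻ˡ _ B dom' , a , a' ,
              ∈-++⁻ˡ A B x∈ , ∈-++⁻ˡ _ B x'∈ , adj-↑ˡ⁻ xx' , refl)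
  ... | right b | right b'
    rewrite trans S'≡ (exchange-↑ʳ A B b b') =
      right _ (dominating-++⁻ʳ A B dom , dominating-++⁻ʳ A _ dom' , b , b' ,
               ∈-++⁻ʳ A B x∈ , ∈-++⁻ʳ A _ x'∈ , adj-↑ʳ⁻ xx' , refl)

  open AutDomFamily

  Product : (Subset m → Set) → (Subset k → Set) → Subset (m + k) → Set
  Product FG FH S = ∃ λ A → ∃ λ B → FG A × FH B × S ≡ A ++ B

  Sectionˡ : (Subset (m + k) → Set) → Subset m → Set
  Sectionˡ F A = ∃ λ B → F (A ++ B)

  Sectionʳ : (Subset (m + k) → Set) → Subset k → Set
  Sectionʳ F B = ∃ λ A → F (A ++ B)

  autDomFamily-Product : ∀ {FG FH} → AutDomFamily G FG → AutDomFamily H FH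
                       → AutDomFamily (G ⊕ H) (Product FG FH)
  dom (autDomFamily-Product famG famH) _ (A , B , A∈ , B∈ , refl) =
    dominating-++⁺ A B (dom famG A A∈) (dom famH B B∈)
  reach (autDomFamily-Product famG famH) _ (A , B , A∈ , B∈ , refl) x x∉
    with splitView m k x
  ... | left a with reach famG A A∈ a (λ a∈ → x∉ (∈-++⁺ˡ A B a∈))
  ...   | A' , A'∈ , AA' , a∈ =
    A' ++ B , (A' , B , A'∈ , B∈ , refl) ,
    adjacentDS-++⁺ˡ A A' B (dom famH B B∈) AA' , ∈-++⁺ˡ A' B a∈
  reach (autDomFamily-Product famG famH) _ (A , B , A∈ , B∈ , refl) x x∉
    | right b with reach famH B B∈ b (λ b∈ → x∉ (∈-++⁺ʳ A B b∈))
  ...   | B' , B'∈ , BB' , b∈ =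
    A ++ B' , (A , B' , A∈ , B'∈ , refl) ,
    adjacentDS-++⁺ʳ A B B' (dom famG A A∈) BB' , ∈-++⁺ʳ A B' b∈
  closed (autDomFamily-Product famG famH) _ (A , B , A∈ , B∈ , refl) S' _ SS'
    with adjacentDS-++⁻ A B S' SS'
  ... | left A' AA'  = A' , B , closed famG A A∈ A' (proj₁ (proj₂ AA')) AA' , B∈ , refl
  ... | right B' BB' = A , B' , A∈ , closed famH B B∈ B' (proj₁ (proj₂ BB')) BB' , refl

  autDomFamily-Sectionˡ : ∀ {F} → AutDomFamily (G ⊕ H) F → AutDomFamily G (Sectionˡ F)
  dom (autDomFamily-Sectionˡ fam) A (B , AB∈) = dominating-++⁻ˡ A B (dom fam _ AB∈)
  reach (autDomFamily-Sectionˡ fam) A (B , AB∈) a a∉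
    with reach fam (A ++ B) AB∈ (a ↑ˡ k) (λ a∈ → a∉ (∈-++⁻ˡ A B a∈))
  ... | S' , S'∈ , SS' , a∈ with adjacentDS-++⁻ A B S' SS'
  ...   | left A' AA'  = A' , (B , S'∈) , AA' , ∈-++⁻ˡ A' B a∈
  ...   | right B' _   = ⊥-elim (a∉ (∈-++⁻ˡ A B' a∈))
  closed (autDomFamily-Sectionˡ fam) A (B , AB∈) A' domA' AA' =
    B , closed fam (A ++ B) AB∈ (A' ++ B) (dominating-++⁺ A' B domA' domB)
                 (adjacentDS-++⁺ˡ A A' B domB AA')
    where domB = dominating-++⁻ʳ A B (dom fam _ AB∈)

  autDomFamily-Sectionʳ : ∀ {F} → AutDomFamily (G ⊕ H) F → AutDomFamily H (Sectionʳ F)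
  dom (autDomFamily-Sectionʳ fam) B (A , AB∈) = dominating-++⁻ʳ A B (dom fam _ AB∈)
  reach (autDomFamily-Sectionʳ fam) B (A , AB∈) b b∉
    with reach fam (A ++ B) AB∈ (m ↑ʳ b) (λ b∈ → b∉ (∈-++⁻ʳ A B b∈))
  ... | S' , S'∈ , SS' , b∈ with adjacentDS-++⁻ A B S' SS'
  ...   | left A' _    = ⊥-elim (b∉ (∈-++⁻ʳ A' B b∈))
  ...   | right B' BB' = B' , (A , S'∈) , BB' , ∈-++⁻ʳ A B' b∈
  closed (autDomFamily-Sectionʳ fam) B (A , AB∈) B' domB' BB' =
    A , closed fam (A ++ B) AB∈ (A ++ B') (dominating-++⁺ A B' domA domB')
                 (adjacentDS-++⁺ʳ A B B' domA BB')
    where domA = dominating-++⁻ˡ A B (dom fam _ AB∈)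

  autonomousDS-++⁺ : ∀ {A B} → AutonomousDS G A → AutonomousDS H B
                   → AutonomousDS (G ⊕ H) (A ++ B)
  autonomousDS-++⁺ {A} {B} (FG , famG , A∈) (FH , famH , B∈) =
    Product FG FH , autDomFamily-Product famG famH , (A , B , A∈ , B∈ , refl)

  autonomousDS-++⁻ˡ : ∀ {A B} → AutonomousDS (G ⊕ H) (A ++ B) → AutonomousDS G A
  autonomousDS-++⁻ˡ {B = B} (F , fam , AB∈) = Sectionˡ F , autDomFamily-Sectionˡ fam , (B , AB∈)

  autonomousDS-++⁻ʳ : ∀ {A B} → AutonomousDS (G ⊕ H) (A ++ B) → AutonomousDS H B
  autonomousDS-++⁻ʳ {A} (F , fam , AB∈) = Sectionʳ F , autDomFamily-Sectionʳ fam , (A , AB∈)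

  isγAut-⊕ : ∀ {kG kH} → IsγAut G kG → IsγAut H kH → IsγAut (G ⊕ H) (kG + kH)
  isγAut-⊕ ((A , autA , ∣A∣) , minG) ((B , autB , ∣B∣) , minH) =
    (A ++ B , autonomousDS-++⁺ autA autB ,
      trans (∣p++q∣≡∣p∣+∣q∣ A B) (cong₂ _+_ ∣A∣ ∣B∣)) ,
    minimal
    where
      minimal : ∀ S → AutonomousDS (G ⊕ H) S → _ ≤ ∣ S ∣
      minimal S autS with Vec.splitAt m S
      ... | A' , B' , refl =
        subst (_ ≤_) (≡.sym (∣p++q∣≡∣p∣+∣q∣ A' B'))
          (+-mono-≤ (minG A' (autonomousDS-++⁻ˡ autS)) (minH B' (autonomousDS-++⁻ʳ autS)))

open DisjointUnion using (isγAut-⊕)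

isγAut-empty : IsγAut emptyGraph 0
isγAut-empty = ([] , ((λ _ → ⊤) , family , tt) , refl) , λ _ _ → z≤n
  where
    family : AutDomFamily emptyGraph (λ _ → ⊤)
    AutDomFamily.dom    family _ _ ()
    AutDomFamily.reach  family _ _ ()
    AutDomFamily.closed family _ _ _ _ (_ , _ , () , _)

mainTheorem17 : (r : ℕ) (G : Fin r → Graph) (k : Fin r → ℕ)
    → (∀ i → IsγAut (G i) (k i))
    → IsγAut (⨁ r G) (sum (tabulate k))
mainTheorem17 zero    G k γ = isγAut-empty
mainTheorem17 (suc r) G k γ =
  isγAut-⊕ (G Fin.zero) (⨁ r (λ i → G (Fin.suc i))) (γ Fin.zero)
    (mainTheorem17 r (λ i → G (Fin.suc i)) (λ i → k (Fin.suc i)) (λ i → γ (Fin.suc i)))
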